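{- Let $k,k_1,k_2\in\mathbb{Z}_{\geq0}$. For each of the following five data (equation; $B$; $\mathbf{Z}=(Z_1,Z_2)$; $D$), consider the generalized cluster pattern $CP_{(\mathbf{x},B,\mathbf{Z})}$ of rank $2$ with initial cluster $\mathbf{x}=(x_1,x_2)$: (i) $x^2+y^2+1=3xy$; $B=\begin{bmatrix}0&2\\-2&0\end{bmatrix}$; $Z_1=Z_2=1+u$; $D=I_2$. (ii) $x^2+y^2+k_1x+1=(3+k_1)xy$; $B=\begin{bmatrix}0&1\\-2&0\end{bmatrix}$; $Z_1=1+u$, $Z_2=1+k_1u+u^2$; $D=\mathrm{diag}(1,2)$. (iii) $x^2+y^2+k_1x+k_2y+1=(3+k_1+k_2)xy$; $B=\begin{bmatrix}0&1\\-1&0\end{bmatrix}$; $Z_1=1+k_2u+u^2$, $Z_2=1+k_1u+u^2$; $D=\mathrm{diag}(2,2)$. (iv) $x^2+y^4+2x+1=5xy^2$; $B=\begin{bmatrix}0&1\\-4&0\end{bmatrix}$; $Z_1=Z_2=1+u$; $D=I_2$. (v) $x^2+y^4+ky^2+2x+1=(5+k)xy^2$; $B=\begin{bmatrix}0&1\\-2&0\end{bmatrix}$; $Z_1=1+ku+u^2$, $Z_2=1+u$; $D=\mathrm{diag}(2,1)$. Then in each case, ignoring exchange matrices and keeping only clusters, the clusters $(x_{1;t},x_{2;t})$, $t\in\mathbb{T}_2$, specialized at $x_1=x_2=1$, give the tree of all positive integer solutions $(x,y)$ of the corresponding equation; that is, the set $\{(x_{1;t},x_{2;t})|_{x_1=x_2=1}: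 t\in\mathbb{T}_2\}$ is exactly the set of positive integer solutions $(x,y)$ of the corresponding equation.
   Context: Generalized cluster patterns (rank $n$). Let $\mathcal{F}$ be the field of rational functions in $n$ indeterminates. A labeled seed is a triple $(\mathbf{x},B,\mathbf{Z})$ where $\mathbf{x}=(x_1,\dots,x_n)$ is a free generating set of $\mathcal{F}$, $B=(b_{ij})$ is an $n\times n$ skew-symmetrizable integer matrix, and $\mathbf{Z}=(Z_1,\dots,Z_n)$ with $Z_i(u)=z_{i,0}+z_{i,1}u+\dots+z_{i,d_i}u^{d_i}$, coefficients in $\mathbb{R}_{>0}$, $z_{i,0}=z_{i,d_i}=1$; $D=\mathrm{diag}(d_1,\dots,d_n)$. Write $[b]_+=\max(b,0)$. The mutation $\mu_k$ sends $(\mathbf{x},B,\mathbf{Z})$ to $(\mathbf{x}',B',\mathbf{Z}')$ where $b'_{ij}=-b_{ij}$ if $i=k$ or $j=k$, and $b'_{ij}=b_{ij}+d_k([b_{ik}]_+b_{kj}+b_{ik}[-b_{kj}]_+)$ otherwise; $x'_k=\left(\prod_{i}x_i^{[-b_{ik}]_+}\right)^{d_k}Z_k\!\left(\prod_i x_i^{b_{ik}}\right)/x_k$ and $x'_j=x_j$ for $j\ne k$; $Z'_k(u)=u^{d_k}Z_k(u^{ -1})$ and $Z'_j=Z_j$ for $j\neq k$. Let $\mathbb{T}_n$ be the $n$-regular tree with edges labeled $1,\dots,n$ so that the edges at each vertex have distinct labels (for $n=2$ an infinite path with alternating labels), with a fixed rooted vertex $t_0$. The generalized cluster pattern $CP_{(\mathbf{x},B,\mathbf{Z})}$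 assigns a labeled seed $\Sigma_t=(\mathbf{x}_t,B_t,\mathbf{Z}_t)$, $\mathbf{x}_t=(x_{1;t},\dots,x_{n;t})$, to each $t\in\mathbb{T}_n$ with $\Sigma_{t_0}=(\mathbf{x},B,\mathbf{Z})$ and $\Sigma_{t'}=\mu_k(\Sigma_t)$ whenever $t,t'$ are joined by an edge labeled $k$. -}

module Defs where

open import Data.Nat using (ℕ; zero; suc; _+_; _*_; _^_) renaming (_<_ to _<ℕ_)
open import Data.Integer as ℤ using (ℤ; +_; -[1+_])
open import Data.Fin as Fin using (Fin; zero; suc)
open import Relation.Nullary using (yes; no)
open import Data.List using (List; []; _∷_; reverse)
open import Data.List.Relation.Unary.Linked using (Linked)
open import Data.Product using (Σ; ∃; _×_; _,_)
open import Relation.Binary.PropositionalEquality using (_≡_; _≢_)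
open import Relation.Nullary using (¬_)

-- Positive rationals as (unnormalised) fractions num / den.
-- Cluster variables of a generalized cluster pattern are subtraction-free
-- rational expressions in x₁,x₂; their specialization at x₁ = x₂ = 1 is
-- obtained by running the mutation formula on the values (1,1) in the
-- semifield of positive rationals.

record Frac : Set where
  constructor _/_
  field
    num : ℕ
    den : ℕ
open Frac public

one : Frac
one = 1 / 1

const : ℕ → Frac
const c = c / 1

_⊕_ : Frac → Frac → Frac
(a / b) ⊕ (c / d) = (a * d + c * b) / (b * d)

_⊗_ : Frac → Frac → Frac
(a / b) ⊗ (c / d) = (a * c) / (b * d)

inv : Frac → Frac
inv (a / b) = b / a

pow : Frac → ℕ → Frac
pow x zero    = one
pow x (suc n) = x ⊗ pow x n

zpow : Frac → ℤ → Frac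
zpow x (+ n)     = pow x n
zpow x -[1+ n ]  = inv (pow x (suc n))

Represents : Frac → ℕ → Set
Represents (a / b) n = (b ≢ 0) × (a ≡ n * b)

-- Polynomials Z(u) = z₀ + z₁ u + … + z_d u^d given by coefficient lists
-- [z₀, z₁, …, z_d]  (all coefficients in this theorem are natural numbers).

Poly : Set
Poly = List ℕ

evalPoly : Poly → Frac → Frac
evalPoly []       u = const 0
evalPoly (c ∷ cs) u = const c ⊕ (u ⊗ evalPoly cs u)

-- u^d Z(u⁻¹) for d = deg Z : reverse the coefficient list
recip : Poly → Poly
recip = reverse

pos : ℤ → ℕ
pos (+ n)    = n
pos -[1+ n ] = 0

posℤ : ℤ → ℤ
posℤ b = + pos b

-- Rank 2 labeled seeds, specialized: the cluster is stored by its values.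

Mat : Set
Mat = Fin 2 → Fin 2 → ℤ

record Seed : Set where
  constructor seed
  field
    x : Fin 2 → Frac
    B : Mat
    Z : Fin 2 → Poly
open Seed public

mutB : (Fin 2 → ℕ) → Fin 2 → Mat → Mat
mutB D k B i j with i Fin.≟ k | j Fin.≟ k
... | yes _ | _     = ℤ.- B i j
... | no _  | yes _ = ℤ.- B i j
... | no _  | no _  =
  B i j ℤ.+ (+ D k) ℤ.* (posℤ (B i k) ℤ.* B k j ℤ.+ B i k ℤ.* posℤ (ℤ.- B k j))

prod2 : (Fin 2 → Frac) → Frac
prod2 f = f zero ⊗ f (suc zero)

mutX : (Fin 2 → ℕ) → Fin 2 → Seed → Fin 2 → Frac
mutX D k (seed x B Z) j with j Fin.≟ k
... | no _  = x j
... | yes _ =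
  (pow (prod2 (λ i → pow (x i) (pos (ℤ.- B i k)))) (D k)
    ⊗ evalPoly (Z k) (prod2 (λ i → zpow (x i) (B i k))))
  ⊗ inv (x k)

mutZ : Fin 2 → (Fin 2 → Poly) → Fin 2 → Poly
mutZ k Z j with j Fin.≟ k
... | no _  = Z j
... | yes _ = recip (Z j)

μ : (Fin 2 → ℕ) → Fin 2 → Seed → Seed
μ D k Σ₀ = seed (mutX D k Σ₀) (mutB D k (B Σ₀)) (mutZ k (Z Σ₀))

-- The 2-regular tree 𝕋₂ rooted at t₀: a vertex t is identified with the
-- sequence of edge labels k₁,…,k_m on the unique path t₀ — t, which is a
-- list with no two consecutive labels equal (a reduced word).

Vertex : Set
Vertex = List (Fin 2)

IsVertex : Vertex → Set
IsVertex = Linked (λ a b → a ≢ b)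

seedAt : (Fin 2 → ℕ) → Seed → Vertex → Seed
seedAt D Σ₀ []       = Σ₀
seedAt D Σ₀ (k ∷ ks) = seedAt D (μ D k Σ₀) ks

initSeed : Mat → (Fin 2 → Poly) → Seed
initSeed B Z = seed (λ _ → one) B Z

GivesAllSolutions : Mat → (Fin 2 → Poly) → (Fin 2 → ℕ) → (ℕ → ℕ → Set) → Set
GivesAllSolutions B Z D Eq =
  ((t : Vertex) → IsVertex t →
     Σ ℕ λ a → Σ ℕ λ b → (0 <ℕ a) × (0 <ℕ b) × Eq a b
       × Represents (x (seedAt D (initSeed B Z) t) zero) a
       × Represents (x (seedAt D (initSeed B Z) t) (suc zero)) b)
  × ((a b : ℕ) → 0 <ℕ a → 0 <ℕ b → Eq a b →
       Σ Vertex λ t → IsVertex t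
         × Represents (x (seedAt D (initSeed B Z) t) zero) a
         × Represents (x (seedAt D (initSeed B Z) t) (suc zero)) b)

mat : ℤ → ℤ → Mat
mat b₁₂ b₂₁ zero       zero       = + 0
mat b₁₂ b₂₁ zero       (suc zero) = b₁₂
mat b₁₂ b₂₁ (suc zero) zero       = b₂₁
mat b₁₂ b₂₁ (suc zero) (suc zero) = + 0

pair : {A : Set} → A → A → Fin 2 → A
pair a b zero       = a
pair a b (suc zero) = b

{-# OPTIONS --safe #-}
-- Every exchange polynomial here is palindromic, so along the pattern the exchange matrix only
-- alternates between B and -B, the coefficients never change, and at x₁ = x₂ = 1 the two
-- mutations act on a cluster (a, b) of positive integers by a a' = Z₁(b^|b₂₁|) and
-- b b' = Z₂(a^|b₁₂|), whatever the signs.  With y = b in cases (i)-(iii) and y = b² in cases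
-- (iv), (v) each equation reads a² + y² + p a + q y + 1 = (3 + p + q) a y, and the mutations are
-- its Vieta involutions in a and in y.  So every cluster is a solution.  Conversely, a positive
-- solution other than (1, 1) has a Vieta neighbour with smaller a + y (if neither move decreases,
-- the smaller coordinate is squeezed to 1), and reading the descent to (1, 1) backwards gives a
-- reduced word whose cluster is the solution.
module Submission where

open import Defs
open import Data.Empty using (⊥-elim)
open import Data.Fin using (Fin; zero; suc)
import Data.Fin as Fin
open import Data.Integer as ℤ using (ℤ; +_; -[1+_])
import Data.Integer.Properties as ℤP
open import Data.List using (List; []; _∷_; _∷ʳ_; last; reverse)
open import Data.List.Relation.Unary.Linked using ([]; [-])
open import Data.List.Relation.Unary.Linked.Properties using (++⁺)
open import Data.Maybe using (Maybe; just; nothing)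
open import Data.Maybe.Properties using (just-injective)
open import Data.Maybe.Relation.Binary.Connected using (Connected; just; nothing-just)
open import Data.Nat using (ℕ; zero; suc; _+_; _*_; _^_; _≤_; _<_; _<?_; s≤s; NonZero; >-nonZero; ≢-nonZero)
open import Data.Nat.Properties
open import Data.Nat.Divisibility using (_∣_; divides; ∣-refl; ∣-trans; m∣m*n; ∣m+n∣m⇒∣n; *-cancelʳ-∣)
open import Data.Nat.DivMod using (m/n*n≡m) renaming (_/_ to _div_)
open import Data.Nat.GCD using (gcd; gcd[m,n]∣m; gcd[m,n]∣n; gcd[m,n]≢0)
open import Data.Nat.Coprimality using (coprime-/gcd; coprime-divisor)
open import Data.Nat.Induction using (<-wellFounded)
open import Data.Nat.Tactic.RingSolver using (solve)
open import Data.Product using (Σ; _×_; _,_; proj₁; proj₂; swap; map₂)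
import Data.Sum as Sum
open import Data.Sum using (_⊎_; inj₁; inj₂)
open import Function.Base using (_on_)
open import Function.Bundles using (_⇔_; mk⇔; Equivalence)
open import Induction.WellFounded using (Acc; acc)
import Relation.Binary.Construct.On as On
open import Relation.Binary.PropositionalEquality
open import Relation.Nullary using (yes; no)

infix 4 _≈_÷_ _≐_

record _≈_÷_ (x : Frac) (r s : ℕ) : Set where
  constructor ≈÷
  field
    0<den : 0 < den x
    0<s   : 0 < s
    cross : num x * s ≡ r * den x
open _≈_÷_

≈-const : ∀ c → const c ≈ c ÷ 1
≈-const c = ≈÷ 0<1+n 0<1+n refl

≈-rescale : ∀ {x r s r' s'} → x ≈ r ÷ s → 0 < s' → r * s' ≡ r' * s → x ≈ r' ÷ s'
≈-rescale {p / q} {r} {s} {r'} {s'} (≈÷ 0<q 0<s ps≡rq) 0<s' rs'≡r's =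
  ≈÷ 0<q 0<s' (*-cancelʳ-≡ (p * s') (r' * q) s {{>-nonZero 0<s}} (begin
    p * s' * s  ≡⟨ solve (p ∷ s' ∷ s ∷ []) ⟩
    p * s * s'  ≡⟨ cong (_* s') ps≡rq ⟩
    r * q * s'  ≡⟨ solve (r ∷ q ∷ s' ∷ []) ⟩
    r * s' * q  ≡⟨ cong (_* q) rs'≡r's ⟩
    r' * s * q  ≡⟨ solve (r' ∷ s ∷ q ∷ []) ⟩
    r' * q * s  ∎))
  where open ≡-Reasoning

≈-⊗ : ∀ {x y r s r' s'} → x ≈ r ÷ s → y ≈ r' ÷ s' → x ⊗ y ≈ r * r' ÷ s * s'
≈-⊗ {p / q} {p' / q'} {r} {s} {r'} {s'} (≈÷ 0<q 0<s e) (≈÷ 0<q' 0<s' e') =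
  ≈÷ (*-mono-< 0<q 0<q') (*-mono-< 0<s 0<s') (begin
    p * p' * (s * s')  ≡⟨ solve (p ∷ p' ∷ s ∷ s' ∷ []) ⟩
    p * s * (p' * s')  ≡⟨ cong₂ _*_ e e' ⟩
    r * q * (r' * q')  ≡⟨ solve (r ∷ q ∷ r' ∷ q' ∷ []) ⟩
    r * r' * (q * q')  ∎)
  where open ≡-Reasoning

≈-⊕ : ∀ {x y r s r' s'} → x ≈ r ÷ s → y ≈ r' ÷ s' → x ⊕ y ≈ r * s' + r' * s ÷ s * s'
≈-⊕ {p / q} {p' / q'} {r} {s} {r'} {s'} (≈÷ 0<q 0<s e) (≈÷ 0<q' 0<s' e') =
  ≈÷ (*-mono-< 0<q 0<q') (*-mono-< 0<s 0<s') (begin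
    (p * q' + p' * q) * (s * s')              ≡⟨ solve (p ∷ p' ∷ q ∷ q' ∷ s ∷ s' ∷ []) ⟩
    p * s * (q' * s') + p' * s' * (q * s)     ≡⟨ cong₂ (λ u v → u * (q' * s') + v * (q * s)) e e' ⟩
    r * q * (q' * s') + r' * q' * (q * s)     ≡⟨ solve (r ∷ r' ∷ q ∷ q' ∷ s ∷ s' ∷ []) ⟩
    (r * s' + r' * s) * (q * q')              ∎)
  where open ≡-Reasoning

≈-inv : ∀ {x r s} → x ≈ r ÷ s → 0 < r → inv x ≈ s ÷ r
≈-inv {zero / q}  (≈÷ 0<q _ 0≡rq) 0<r = ⊥-elim (<⇒≢ (*-mono-< 0<r 0<q) 0≡rq)
≈-inv {suc p / q} {r} {s} (≈÷ _ _ e) 0<r =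
  ≈÷ 0<1+n 0<r (trans (*-comm q r) (trans (sym e) (*-comm (suc p) s)))

≈-pow : ∀ {x r} n → x ≈ r ÷ 1 → pow x n ≈ r ^ n ÷ 1
≈-pow zero    _ = ≈-const 1
≈-pow (suc n) h = ≈-⊗ h (≈-pow n h)

≈-one⊗ : ∀ {x r s} → x ≈ r ÷ s → one ⊗ x ≈ r ÷ s
≈-one⊗ {r = r} {s} h = ≈-rescale (≈-⊗ (≈-const 1) h) (0<s h) (solve (r ∷ s ∷ []))

≈-⊗one : ∀ {x r s} → x ≈ r ÷ s → x ⊗ one ≈ r ÷ s
≈-⊗one {r = r} {s} h = ≈-rescale (≈-⊗ h (≈-const 1)) (0<s h) (solve (r ∷ s ∷ []))

represents : ∀ {x n} → x ≈ n ÷ 1 → Represents x n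
represents {p / q} (≈÷ 0<q _ e) = (λ q≡0 → <⇒≢ 0<q (sym q≡0)) , trans (sym (*-identityʳ p)) e

-- Only the two shapes occurring in Theorem 5.4; what the proof uses is that they are palindromic.
data ExchangePolynomial : Poly → ℕ → (ℕ → ℕ) → Set where
  linear    : ExchangePolynomial (1 ∷ 1 ∷ []) 1 (λ v → 1 + v)
  quadratic : ∀ c → ExchangePolynomial (1 ∷ c ∷ 1 ∷ []) 2 (λ v → 1 + c * v + v * v)

palindromic : ∀ {Z d V} → ExchangePolynomial Z d V → reverse Z ≡ Z
palindromic linear        = refl
palindromic (quadratic c) = refl

evalPoly-linear-≈ : ∀ {u r s} → u ≈ r ÷ s → evalPoly (1 ∷ 1 ∷ []) u ≈ s + r ÷ s
evalPoly-linear-≈ {r = r} {s} h =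
  ≈-rescale (≈-⊕ (≈-const 1) (≈-⊗ h (≈-⊕ (≈-const 1) (≈-⊗ h (≈-const 0))))) (0<s h)
    (solve (r ∷ s ∷ []))

evalPoly-quadratic-≈ : ∀ {u r s} c → u ≈ r ÷ s →
                       evalPoly (1 ∷ c ∷ 1 ∷ []) u ≈ s * s + c * r * s + r * r ÷ s * s
evalPoly-quadratic-≈ {r = r} {s} c h =
  ≈-rescale (≈-⊕ (≈-const 1) (≈-⊗ h (≈-⊕ (≈-const c) (≈-⊗ h (≈-⊕ (≈-const 1) (≈-⊗ h (≈-const 0)))))))
    (*-mono-< (0<s h) (0<s h)) (solve (r ∷ s ∷ c ∷ []))

-- The monomials ∏ᵢ xᵢ^[-bᵢₖ]₊ and ∏ᵢ xᵢ^bᵢₖ of the exchange relation, at a point where ∏ᵢ xᵢ^|bᵢₖ| = v.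
data ExchangeMonomials (A U : Frac) (v : ℕ) : Set where
  neg-entry : A ≈ v ÷ 1 → U ≈ 1 ÷ v → ExchangeMonomials A U v
  pos-entry : A ≈ 1 ÷ 1 → U ≈ v ÷ 1 → ExchangeMonomials A U v

monomials-neg : ∀ {y b} m → y ≈ b ÷ 1 → 0 < b →
                ExchangeMonomials (pow y (suc m)) (inv (pow y (suc m))) (b ^ suc m)
monomials-neg {b = b} m y≈b 0<b =
  neg-entry (≈-pow (suc m) y≈b) (≈-inv (≈-pow (suc m) y≈b) (m^n>0 b {{>-nonZero 0<b}} (suc m)))

monomials-pos : ∀ {y b} m → y ≈ b ÷ 1 → ExchangeMonomials one (pow y (suc m)) (b ^ suc m)
monomials-pos m y≈b = pos-entry (≈-const 1) (≈-pow (suc m) y≈b)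

monomials-one⊗ : ∀ {A U v} → ExchangeMonomials A U v → ExchangeMonomials (one ⊗ A) (one ⊗ U) v
monomials-one⊗ (neg-entry hA hU) = neg-entry (≈-one⊗ hA) (≈-one⊗ hU)
monomials-one⊗ (pos-entry hA hU) = pos-entry (≈-one⊗ hA) (≈-one⊗ hU)

monomials-⊗one : ∀ {A U v} → ExchangeMonomials A U v → ExchangeMonomials (A ⊗ one) (U ⊗ one) v
monomials-⊗one (neg-entry hA hU) = neg-entry (≈-⊗one hA) (≈-⊗one hU)
monomials-⊗one (pos-entry hA hU) = pos-entry (≈-⊗one hA) (≈-⊗one hU)

-- For a negative entry this is v^d Z(1/v) = Z(v), i.e. palindromicity of Z.
numerator-≈ : ∀ {Z d V A U v} → ExchangePolynomial Z d V → ExchangeMonomials A U v →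
              pow A d ⊗ evalPoly Z U ≈ V v ÷ 1
numerator-≈ {v = v} linear (neg-entry hA hU) =
  ≈-rescale (≈-⊗ (≈-⊗ hA (≈-const 1)) (evalPoly-linear-≈ hU)) 0<1+n (solve (v ∷ []))
numerator-≈ {v = v} linear (pos-entry hA hU) =
  ≈-rescale (≈-⊗ (≈-⊗ hA (≈-const 1)) (evalPoly-linear-≈ hU)) 0<1+n (solve (v ∷ []))
numerator-≈ {v = v} (quadratic c) (neg-entry hA hU) =
  ≈-rescale (≈-⊗ (≈-⊗ hA (≈-⊗ hA (≈-const 1))) (evalPoly-quadratic-≈ c hU)) 0<1+n (solve (v ∷ c ∷ []))
numerator-≈ {v = v} (quadratic c) (pos-entry hA hU) =
  ≈-rescale (≈-⊗ (≈-⊗ hA (≈-⊗ hA (≈-const 1))) (evalPoly-quadratic-≈ c hU)) 0<1+n (solve (v ∷ c ∷ []))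

exchange-≈ : ∀ {Z d V A U v x a a'} → ExchangePolynomial Z d V → ExchangeMonomials A U v →
             x ≈ a ÷ 1 → 0 < a → a * a' ≡ V v → (pow A d ⊗ evalPoly Z U) ⊗ inv x ≈ a' ÷ 1
exchange-≈ {a = a} {a'} shape monomials x≈a 0<a exchange =
  ≈-rescale (≈-⊗ (numerator-≈ shape monomials) (≈-inv x≈a 0<a)) 0<1+n (rearrange exchange)
  where
  rearrange : ∀ {n} → a * a' ≡ n → n * 1 * 1 ≡ a' * (1 * a)
  rearrange refl = solve (a ∷ a' ∷ [])

_≐_ : Mat → Mat → Set
M ≐ N = ∀ i j → M i j ≡ N i j

mutB-cong : ∀ D k {M N} → M ≐ N → mutB D k M ≐ mutB D k N
mutB-cong D k M≐N i j with i Fin.≟ k | j Fin.≟ k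
... | yes _ | _     = cong ℤ.-_ (M≐N i j)
... | no _  | yes _ = cong ℤ.-_ (M≐N i j)
... | no _  | no _  rewrite M≐N i j | M≐N i k | M≐N k j = refl

data OppositeSigns : ℤ → ℤ → Set where
  pos-neg : ∀ m n → OppositeSigns (+ suc m) -[1+ n ]
  neg-pos : ∀ m n → OppositeSigns -[1+ m ] (+ suc n)

opposite-signs-sym : ∀ {u v} → OppositeSigns u v → OppositeSigns v u
opposite-signs-sym (pos-neg m n) = neg-pos n m
opposite-signs-sym (neg-pos m n) = pos-neg n m

-- The entry b'ᵢᵢ (i ≠ k) of μₖ(B) when bᵢᵢ = 0: it stays 0 because bᵢₖ and bₖᵢ have opposite signs.
sign-coherent : ∀ d {u v} → OppositeSigns u v →
                + 0 ℤ.+ + d ℤ.* (posℤ u ℤ.* v ℤ.+ u ℤ.* posℤ (ℤ.- v)) ≡ + 0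
sign-coherent d (pos-neg m n)
  rewrite sym (ℤP.*-distribˡ-+ (+ suc m) (ℤ.- (+ suc n)) (+ suc n))
        | ℤP.+-inverseˡ (+ suc n) | ℤP.*-zeroʳ (+ suc m) | ℤP.*-zeroʳ (+ d) = refl
sign-coherent d (neg-pos m n) rewrite ℤP.*-zeroʳ -[1+ m ] | ℤP.*-zeroʳ (+ d) = refl

mutB-mat : ∀ D k {u v} → OppositeSigns u v → mutB D k (mat u v) ≐ mat (ℤ.- u) (ℤ.- v)
mutB-mat D zero       uv zero       zero       = refl
mutB-mat D zero       uv zero       (suc zero) = refl
mutB-mat D zero       uv (suc zero) zero       = refl
mutB-mat D zero       uv (suc zero) (suc zero) = sign-coherent (D zero) (opposite-signs-sym uv)
mutB-mat D (suc zero) uv zero       zero       = sign-coherent (D (suc zero)) uv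
mutB-mat D (suc zero) uv zero       (suc zero) = refl
mutB-mat D (suc zero) uv (suc zero) zero       = refl
mutB-mat D (suc zero) uv (suc zero) (suc zero) = refl

-- Vieta jumping

positive-factor : ∀ m {n o} → m * n ≡ o → 0 < o → 0 < n
positive-factor m {zero}  refl 0<o = ⊥-elim (<⇒≢ 0<o (sym (*-zeroʳ m)))
positive-factor m {suc n} _    _   = 0<1+n

roots-sum : ∀ {u u' L P M} → 0 < u → u * u + L * u + P ≡ M * u → u * u' ≡ P → u + L + u' ≡ M
roots-sum {u} {u'} {L} {P} {M} 0<u root product =
  *-cancelʳ-≡ (u + L + u') M u {{>-nonZero 0<u}} (begin
    (u + L + u') * u        ≡⟨ solve (u ∷ L ∷ u' ∷ []) ⟩
    u * u + L * u + u * u'  ≡⟨ cong (_+_ (u * u + L * u)) product ⟩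
    u * u + L * u + P       ≡⟨ root ⟩
    M * u                   ∎)
  where open ≡-Reasoning

partner-root : ∀ {u u' L P M} → 0 < u → u * u + L * u + P ≡ M * u → u * u' ≡ P →
               u' * u' + L * u' + P ≡ M * u'
partner-root {u} {u'} {L} {P} {M} 0<u root product = begin
  u' * u' + L * u' + P       ≡⟨ cong (_+_ (u' * u' + L * u')) (sym product) ⟩
  u' * u' + L * u' + u * u'  ≡⟨ solve (u' ∷ L ∷ u ∷ []) ⟩
  (u + L + u') * u'          ≡⟨ cong (_* u') (roots-sum {L = L} {M = M} 0<u root product) ⟩
  M * u'                     ∎
  where open ≡-Reasoning

other-root : ∀ {u L P M} → 0 < u → u * u + L * u + P ≡ M * u →
             Σ ℕ λ u' → u * u' ≡ P × u' * u' + L * u' + P ≡ M * u'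
other-root {u} {L} {P} {M} 0<u root =
  let divides u' P≡u'u = ∣m+n∣m⇒∣n (divides M root) (divides (u + L) factored)
      product = trans (*-comm u u') (sym P≡u'u)
  in u' , product , partner-root {L = L} {M = M} 0<u root product
  where
  factored : u * u + L * u ≡ (u + L) * u
  factored = solve (u ∷ L ∷ [])

-- (u - c) (u' - c) ≥ 0
product-bound : ∀ {c u u'} → c ≤ u → u ≤ u' → c * (u + u') ≤ c * c + u * u'
product-bound {c} c≤u u≤u' with m≤n⇒∃[o]m+o≡n c≤u | m≤n⇒∃[o]m+o≡n u≤u'
... | s , refl | t , refl = begin
    c * (c + s + (c + s + t))                    ≤⟨ m≤m+n _ (s * s + s * t) ⟩
    c * (c + s + (c + s + t)) + (s * s + s * t)  ≡⟨ solve (c ∷ s ∷ t ∷ []) ⟩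
    c * c + (c + s) * (c + s + t)                ∎
  where open ≤-Reasoning

square-bound : ∀ {a} k → 0 < a → (1 + k) * (a * a) ≤ k * a + 1 → a ≡ 1
square-bound {suc zero}    k _ _ = refl
square-bound {suc (suc a)} k _ bound =
  ⊥-elim (m+1+n≰m (k * (2 + a) + 1) (subst (_≤ k * (2 + a) + 1) expand bound))
  where
  expand : (1 + k) * ((2 + a) * (2 + a)) ≡ k * (2 + a) + 1 + suc (2 + 4 * a + a * a + k * (2 + a) * (1 + a))
  expand = solve (k ∷ a ∷ [])

-- u + u' = 1 + u u' says (u - 1) (u' - 1) = 0
sum-product-one : ∀ {u u'} → 0 < u → u ≤ u' → u + u' ≡ 1 + u * u' → u ≡ 1
sum-product-one {suc u₀} {suc u₁} _ u≤u' eq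
  with m*n≡0⇒m≡0∨n≡0 u₀ (+-cancelˡ-≡ (2 + u₀ + u₁) (u₀ * u₁) 0 (begin
    2 + u₀ + u₁ + u₀ * u₁        ≡⟨ solve (u₀ ∷ u₁ ∷ []) ⟩
    1 + (1 + u₀) * (1 + u₁)      ≡⟨ sym eq ⟩
    (1 + u₀) + (1 + u₁)          ≡⟨ solve (u₀ ∷ u₁ ∷ []) ⟩
    2 + u₀ + u₁ + 0              ∎))
  where open ≡-Reasoning
... | inj₁ refl = refl
sum-product-one {suc zero}    {suc zero} _ _         _ | inj₂ refl = refl
sum-product-one {suc (suc _)} {suc zero} _ (s≤s ()) _ | inj₂ refl

square-<-reflect : ∀ {m n} → m * m < n * n → m < n
square-<-reflect m*m<n*n = ≰⇒> (λ n≤m → <⇒≱ m*m<n*n (*-mono-≤ n≤m n≤m))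

square-∣-square : ∀ {m n} → 0 < m → m * m ∣ n * n → m ∣ n
square-∣-square {m@(suc _)} {n} _ m*m∣n*n = subst (_∣ n) g≡m (gcd[m,n]∣n m n)
  where
  g : ℕ
  g = gcd m n
  instance
    g≢0 : NonZero g
    g≢0 = ≢-nonZero (gcd[m,n]≢0 m n (inj₁ λ ()))
    g*g≢0 : NonZero (g * g)
    g*g≢0 = m*n≢0 g g
  m₁ n₁ : ℕ
  m₁ = m div g
  n₁ = n div g
  squared : ∀ {k k₁ h} → k₁ * h ≡ k → k * k ≡ k₁ * k₁ * (h * h)
  squared {k₁ = k₁} {h} refl = solve (k₁ ∷ h ∷ [])
  m₁∣n₁ : m₁ ∣ n₁
  m₁∣n₁ = coprime-divisor (coprime-/gcd m n)
    (∣-trans (m∣m*n m₁) (*-cancelʳ-∣ (g * g)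
      (subst₂ _∣_ (squared {k₁ = m₁} {g} (m/n*n≡m (gcd[m,n]∣m m n)))
                  (squared {k₁ = n₁} {g} (m/n*n≡m (gcd[m,n]∣n m n))) m*m∣n*n)))
  g≡m : g ≡ m
  g≡m = begin
    g       ≡⟨ sym (*-identityˡ g) ⟩
    1 * g   ≡⟨ cong (_* g) (sym (coprime-/gcd m n (∣-refl , m₁∣n₁))) ⟩
    m₁ * g  ≡⟨ m/n*n≡m (gcd[m,n]∣m m n) ⟩
    m       ∎
    where open ≡-Reasoning

square-partner : ∀ {b Y' n} → 0 < b → b * b * Y' ≡ n * n → Σ ℕ λ b' → b * b' ≡ n × Y' ≡ b' * b'
square-partner {b} {Y'} {n} 0<b product =
  let divides b' n≡b'b = square-∣-square 0<b (divides Y' (trans (sym product) (*-comm (b * b) Y')))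
  in b' , trans (*-comm b b') (sym n≡b'b) , Y'≡b'*b' b' n≡b'b
  where
  open ≡-Reasoning
  Y'≡b'*b' : ∀ b' → n ≡ b' * b → Y' ≡ b' * b'
  Y'≡b'*b' b' n≡b'b = *-cancelʳ-≡ Y' (b' * b') (b * b) {{>-nonZero (*-mono-< 0<b 0<b)}} (begin
    Y' * (b * b)         ≡⟨ *-comm Y' (b * b) ⟩
    b * b * Y'           ≡⟨ product ⟩
    n * n                ≡⟨ cong (λ k → k * k) n≡b'b ⟩
    b' * b * (b' * b)    ≡⟨ solve (b ∷ b' ∷ []) ⟩
    b' * b' * (b * b)    ∎)

Q : ℕ → ℕ → ℕ
Q p a = a * a + p * a + 1

-- a² + y² + p a + q y + 1 = (3 + p + q) a y; a record, so that p, q, a, y are inferable from a proof.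
record Markov (p q a y : ℕ) : Set where
  constructor markov
  field equation : a * a + p * a + Q q y ≡ (3 + p + q) * y * a
open Markov

markov-rearranged : ∀ {p q a y l r} → a * a + p * a + Q q y ≡ l → (3 + p + q) * y * a ≡ r →
                    Markov p q a y ⇔ (l ≡ r)
markov-rearranged refl refl = mk⇔ equation markov

markov-swap : ∀ {p q a y} → Markov p q a y → Markov q p y a
markov-swap {p} {q} {a} {y} (markov eq) = markov (begin
  y * y + q * y + (a * a + p * a + 1)  ≡⟨ solve (a ∷ y ∷ p ∷ q ∷ []) ⟩
  a * a + p * a + (y * y + q * y + 1)  ≡⟨ eq ⟩
  (3 + p + q) * y * a                  ≡⟨ solve (a ∷ y ∷ p ∷ q ∷ []) ⟩
  (3 + q + p) * a * y                  ∎)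
  where open ≡-Reasoning

markov-jump : ∀ {p q a y} → Markov p q a y → 0 < a →
              Σ ℕ λ a' → a * a' ≡ Q q y × 0 < a' × Markov p q a' y
markov-jump {p} {q} {a} {y} (markov eq) 0<a =
  let a' , product , eq' = other-root {L = p} {M = (3 + p + q) * y} 0<a eq
  in a' , product , positive-factor a product (m≤n+m 1 (y * y + q * y)) , markov eq'

markov-partner-sum : ∀ {p q a y y'} → Markov p q a y → 0 < y → y * y' ≡ Q p a →
                     y + q + y' ≡ (3 + q + p) * a
markov-partner-sum {p} {q} {a} m 0<y product =
  roots-sum {L = q} {M = (3 + q + p) * a} 0<y (equation (markov-swap m)) product

markov-left-root : ∀ {p q a y y'} → Markov p q a y → 0 < a → a ≤ y → y ≤ y' → y * y' ≡ Q p a → a ≡ 1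
markov-left-root {p} {q} {a} {y} {y'} m 0<a a≤y y≤y' product =
  square-bound (p + q) 0<a (+-cancelˡ-≤ (2 * (a * a)) _ _ (begin
    2 * (a * a) + (1 + (p + q)) * (a * a)  ≡⟨ solve (a ∷ p ∷ q ∷ []) ⟩
    a * ((3 + q + p) * a)                  ≡⟨ cong (a *_) (markov-partner-sum m (<-≤-trans 0<a a≤y) product) ⟨
    a * (y + q + y')                       ≡⟨ solve (a ∷ y ∷ q ∷ y' ∷ []) ⟩
    a * (y + y') + a * q                   ≤⟨ +-monoˡ-≤ (a * q) (product-bound a≤y y≤y') ⟩
    a * a + y * y' + a * q                 ≡⟨ cong (λ z → a * a + z + a * q) product ⟩
    a * a + (a * a + p * a + 1) + a * q    ≡⟨ solve (a ∷ p ∷ q ∷ []) ⟩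
    2 * (a * a) + ((p + q) * a + 1)        ∎))
  where open ≤-Reasoning

markov-unit-sum : ∀ {p q y y'} → Markov p q 1 y → 0 < y → y * y' ≡ Q p 1 → y + y' ≡ 1 + y * y'
markov-unit-sum {p} {q} {y} {y'} m 0<y product = +-cancelʳ-≡ q (y + y') (1 + y * y') (begin
  y + y' + q                       ≡⟨ solve (y ∷ y' ∷ q ∷ []) ⟩
  y + q + y'                       ≡⟨ markov-partner-sum m 0<y product ⟩
  (3 + q + p) * 1                  ≡⟨ solve (p ∷ q ∷ []) ⟩
  1 + (1 * 1 + p * 1 + 1) + q      ≡⟨ cong (λ z → 1 + z + q) product ⟨
  1 + y * y' + q                   ∎)
  where open ≡-Reasoning

markov-minimal : ∀ {p q a y y'} → Markov p q a y → 0 < a → a ≤ y → y ≤ y' → y * y' ≡ Q p a →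
                 a ≡ 1 × y ≡ 1
markov-minimal {p} {q} {a} {y} {y'} m 0<a a≤y y≤y' product = a≡1 , y≡1 a≡1 m product
  where
  a≡1 : a ≡ 1
  a≡1 = markov-left-root m 0<a a≤y y≤y' product
  0<y : 0 < y
  0<y = <-≤-trans 0<a a≤y
  y≡1 : ∀ {a} → a ≡ 1 → Markov p q a y → y * y' ≡ Q p a → y ≡ 1
  y≡1 refl m₁ product₁ = sum-product-one 0<y y≤y' (markov-unit-sum m₁ 0<y product₁)

markov-descent : ∀ {p q a y a' y'} → Markov p q a y → 0 < a → 0 < y →
                 a * a' ≡ Q q y → y * y' ≡ Q p a → (a ≡ 1 × y ≡ 1) ⊎ (a' < a ⊎ y' < y)
markov-descent {a = a} {y} {a'} {y'} m 0<a 0<y product-a product-y with a' <? a | y' <? y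
... | yes a'<a | _        = inj₂ (inj₁ a'<a)
... | no _     | yes y'<y = inj₂ (inj₂ y'<y)
... | no a'≮a  | no y'≮y with ≤-total a y
...   | inj₁ a≤y = inj₁ (markov-minimal m 0<a a≤y (≮⇒≥ y'≮y) product-y)
...   | inj₂ y≤a = inj₁ (swap (markov-minimal (markov-swap m) 0<y y≤a (≮⇒≥ a'≮a) product-a))

Solution : (ℕ → ℕ → Set) → ℕ → ℕ → Set
Solution Eq a b = 0 < a × 0 < b × Eq a b

record SolutionTree (V₀ V₁ : ℕ → ℕ) (Eq : ℕ → ℕ → Set) : Set where
  field
    root    : Eq 1 1
    jump₀   : ∀ {a b} → Solution Eq a b → Σ ℕ λ a' → a * a' ≡ V₀ b × Solution Eq a' b
    jump₁   : ∀ {a b} → Solution Eq a b → Σ ℕ λ b' → b * b' ≡ V₁ a × Solution Eq a b'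
    descent : ∀ {a b a' b'} → Solution Eq a b → a * a' ≡ V₀ b → b * b' ≡ V₁ a →
              (a ≡ 1 × b ≡ 1) ⊎ (a' < a ⊎ b' < b)

SolutionTree-resp : ∀ {V₀ V₁ V₀' V₁' Eq Eq'} → (∀ b → V₀ b ≡ V₀' b) → (∀ a → V₁ a ≡ V₁' a) →
                    (∀ {a b} → Eq a b ⇔ Eq' a b) → SolutionTree V₀ V₁ Eq → SolutionTree V₀' V₁' Eq'
SolutionTree-resp {Eq = Eq} {Eq'} V₀≡ V₁≡ Eq⇔Eq' tree = record
  { root    = to root
  ; jump₀   = λ sol → let a' , product , sol' = jump₀ (from-solution sol)
                      in a' , trans product (V₀≡ _) , to-solution sol'
  ; jump₁   = λ sol → let b' , product , sol' = jump₁ (from-solution sol)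
                      in b' , trans product (V₁≡ _) , to-solution sol'
  ; descent = λ sol product₀ product₁ →
      descent (from-solution sol) (trans product₀ (sym (V₀≡ _))) (trans product₁ (sym (V₁≡ _)))
  }
  where
  open SolutionTree tree
  to : ∀ {a b} → Eq a b → Eq' a b
  to = Equivalence.to Eq⇔Eq'
  to-solution : ∀ {a b} → Solution Eq a b → Solution Eq' a b
  to-solution = map₂ (map₂ to)
  from-solution : ∀ {a b} → Solution Eq' a b → Solution Eq a b
  from-solution = map₂ (map₂ (Equivalence.from Eq⇔Eq'))

markov-tree : ∀ p q → SolutionTree (Q q) (Q p) (Markov p q)
markov-tree p q = record
  { root    = markov root
  ; jump₀   = λ (0<a , 0<b , m) → let a' , product , 0<a' , m' = markov-jump m 0<a
                                   in a' , product , 0<a' , 0<b , m'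
  ; jump₁   = λ (0<a , 0<b , m) → let b' , product , 0<b' , m' = markov-jump (markov-swap m) 0<b
                                   in b' , product , 0<a , 0<b' , markov-swap m'
  ; descent = λ (0<a , 0<b , m) → markov-descent m 0<a 0<b
  }
  where
  root : 1 * 1 + p * 1 + (1 * 1 + q * 1 + 1) ≡ (3 + p + q) * 1 * 1
  root = solve (p ∷ q ∷ [])

-- In the variable y = b² the move y y' = Q 2 a = (1 + a)² stays among squares (square-partner),
-- where it is the move b b' = 1 + a.
square-markov-tree : ∀ q → SolutionTree (λ b → Q q (b * b)) suc (λ a b → Markov 2 q a (b * b))
square-markov-tree q = record
  { root    = SolutionTree.root (markov-tree 2 q)
  ; jump₀   = λ (0<a , 0<b , m) → let a' , product , 0<a' , m' = markov-jump m 0<a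
                                   in a' , product , 0<a' , 0<b , m'
  ; jump₁   = b-jump
  ; descent = λ {a} {b} {_} {b'} (0<a , 0<b , m) product₀ product₁ →
      Sum.map (map₂ (m*n≡1⇒m≡1 b b)) (Sum.map₂ square-<-reflect)
              (markov-descent m 0<a (*-mono-< 0<b 0<b) product₀ (squared {a} {b} {b'} product₁))
  }
  where
  Q2≡square : ∀ a → a * a + 2 * a + 1 ≡ (1 + a) * (1 + a)
  Q2≡square a = solve (a ∷ [])
  squared : ∀ {a b b'} → b * b' ≡ 1 + a → b * b * (b' * b') ≡ Q 2 a
  squared {a} {b} {b'} product = begin
    b * b * (b' * b')    ≡⟨ solve (b ∷ b' ∷ []) ⟩
    b * b' * (b * b')    ≡⟨ cong (λ k → k * k) product ⟩
    (1 + a) * (1 + a)    ≡⟨ Q2≡square a ⟨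
    a * a + 2 * a + 1    ∎
    where open ≡-Reasoning
  b-jump : ∀ {a b} → Solution (λ a b → Markov 2 q a (b * b)) a b →
           Σ ℕ λ b' → b * b' ≡ suc a × Solution (λ a b → Markov 2 q a (b * b)) a b'
  b-jump {a} {b} (0<a , 0<b , m) =
    let Y' , product , _ , m' = markov-jump (markov-swap m) (*-mono-< 0<b 0<b)
        b' , b*b'≡1+a , Y'≡b'*b' = square-partner 0<b (trans product (Q2≡square a))
    in b' , b*b'≡1+a , 0<a , positive-factor b b*b'≡1+a 0<1+n ,
       markov-swap (subst (λ Y → Markov q 2 Y a) Y'≡b'*b' m')

-- Rank 2 patterns with palindromic exchange polynomials

last-∷ʳ : ∀ {A : Set} (xs : List A) y → last (xs ∷ʳ y) ≡ just y
last-∷ʳ []           y = refl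
last-∷ʳ (x ∷ [])     y = refl
last-∷ʳ (x ∷ x' ∷ xs) y = last-∷ʳ (x' ∷ xs) y

seedAt-∷ʳ : ∀ D s t k → seedAt D s (t ∷ʳ k) ≡ μ D k (seedAt D s t)
seedAt-∷ʳ D s []      k = refl
seedAt-∷ʳ D s (k' ∷ t) k = seedAt-∷ʳ D (μ D k' s) t k

module ClusterPattern (c e : ℕ) {Z₀ Z₁ : Poly} {d₀ d₁ : ℕ} {V₀ V₁ : ℕ → ℕ}
  (shape₀ : ExchangePolynomial Z₀ d₀ V₀) (shape₁ : ExchangePolynomial Z₁ d₁ V₁) where

  D : Fin 2 → ℕ
  D = pair d₀ d₁

  B₊ B₋ : Mat
  B₊ = mat (+ suc c) -[1+ e ]
  B₋ = mat -[1+ c ] (+ suc e)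

  S₀ : Seed
  S₀ = initSeed B₊ (pair Z₀ Z₁)

  -- Thanks to palindromicity the specialised exchange relations do not depend on the sign of B.
  data Exchange : Fin 2 → ℕ × ℕ → ℕ × ℕ → Set where
    exchange₀ : ∀ {a b a'} → a * a' ≡ V₀ (b ^ suc e) → Exchange zero (a , b) (a' , b)
    exchange₁ : ∀ {a b b'} → b * b' ≡ V₁ (a ^ suc c) → Exchange (suc zero) (a , b) (a , b')

  Positive : ℕ × ℕ → Set
  Positive (a , b) = 0 < a × 0 < b

  exchange-sym : ∀ {k v w} → Exchange k v w → Exchange k w v
  exchange-sym (exchange₀ {a} {a' = a'} product) = exchange₀ (trans (*-comm a' a) product)
  exchange-sym (exchange₁ {b = b} {b'} product) = exchange₁ (trans (*-comm b' b) product)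

  exchange-unique : ∀ {k v w w'} → Positive v → Exchange k v w → Exchange k v w' → w ≡ w'
  exchange-unique {v = a , b} (0<a , _) (exchange₀ {a' = a'} p) (exchange₀ {a' = a''} p') =
    cong (_, b) (*-cancelˡ-≡ a' a'' a {{>-nonZero 0<a}} (trans p (sym p')))
  exchange-unique {v = a , b} (_ , 0<b) (exchange₁ {b' = b'} p) (exchange₁ {b' = b''} p') =
    cong (a ,_) (*-cancelˡ-≡ b' b'' b {{>-nonZero 0<b}} (trans p (sym p')))

  record Specialises (s : Seed) (v : ℕ × ℕ) : Set where
    constructor specialisation
    field
      matrix       : B s ≐ B₊ ⊎ B s ≐ B₋
      coefficients : ∀ i → Z s i ≡ pair Z₀ Z₁ i
      cluster₀     : x s zero ≈ proj₁ v ÷ 1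
      cluster₁     : x s (suc zero) ≈ proj₂ v ÷ 1
  open Specialises

  matrix-μ : ∀ k {M} → M ≐ B₊ ⊎ M ≐ B₋ → mutB D k M ≐ B₊ ⊎ mutB D k M ≐ B₋
  matrix-μ k (inj₁ M≐B₊) =
    inj₂ λ i j → trans (mutB-cong D k M≐B₊ i j) (mutB-mat D k (pos-neg c e) i j)
  matrix-μ k (inj₂ M≐B₋) =
    inj₁ λ i j → trans (mutB-cong D k M≐B₋ i j) (mutB-mat D k (neg-pos c e) i j)

  coefficients-μ : ∀ k {Zs} → (∀ i → Zs i ≡ pair Z₀ Z₁ i) → ∀ i → mutZ k Zs i ≡ pair Z₀ Z₁ i
  coefficients-μ zero       Zs≡ zero       rewrite Zs≡ zero = palindromic shape₀
  coefficients-μ zero       Zs≡ (suc zero) = Zs≡ (suc zero)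
  coefficients-μ (suc zero) Zs≡ zero       = Zs≡ zero
  coefficients-μ (suc zero) Zs≡ (suc zero) rewrite Zs≡ (suc zero) = palindromic shape₁

  cluster-μ₀ : ∀ {xs Bs Zs a b a'} → Bs ≐ B₊ ⊎ Bs ≐ B₋ → Zs zero ≡ Z₀ →
               xs zero ≈ a ÷ 1 → xs (suc zero) ≈ b ÷ 1 → 0 < a → 0 < b → a * a' ≡ V₀ (b ^ suc e) →
               mutX D zero (seed xs Bs Zs) zero ≈ a' ÷ 1
  cluster-μ₀ (inj₁ Bs≐B₊) Zs≡Z₀ x₀≈a x₁≈b 0<a 0<b exchange
    rewrite Bs≐B₊ zero zero | Bs≐B₊ (suc zero) zero | Zs≡Z₀ =
    exchange-≈ shape₀ (monomials-one⊗ (monomials-neg e x₁≈b 0<b)) x₀≈a 0<a exchange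
  cluster-μ₀ (inj₂ Bs≐B₋) Zs≡Z₀ x₀≈a x₁≈b 0<a 0<b exchange
    rewrite Bs≐B₋ zero zero | Bs≐B₋ (suc zero) zero | Zs≡Z₀ =
    exchange-≈ shape₀ (monomials-one⊗ (monomials-pos e x₁≈b)) x₀≈a 0<a exchange

  cluster-μ₁ : ∀ {xs Bs Zs a b b'} → Bs ≐ B₊ ⊎ Bs ≐ B₋ → Zs (suc zero) ≡ Z₁ →
               xs zero ≈ a ÷ 1 → xs (suc zero) ≈ b ÷ 1 → 0 < a → 0 < b → b * b' ≡ V₁ (a ^ suc c) →
               mutX D (suc zero) (seed xs Bs Zs) (suc zero) ≈ b' ÷ 1
  cluster-μ₁ (inj₁ Bs≐B₊) Zs≡Z₁ x₀≈a x₁≈b 0<a 0<b exchange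
    rewrite Bs≐B₊ zero (suc zero) | Bs≐B₊ (suc zero) (suc zero) | Zs≡Z₁ =
    exchange-≈ shape₁ (monomials-⊗one (monomials-pos c x₀≈a)) x₁≈b 0<b exchange
  cluster-μ₁ (inj₂ Bs≐B₋) Zs≡Z₁ x₀≈a x₁≈b 0<a 0<b exchange
    rewrite Bs≐B₋ zero (suc zero) | Bs≐B₋ (suc zero) (suc zero) | Zs≡Z₁ =
    exchange-≈ shape₁ (monomials-⊗one (monomials-neg c x₀≈a 0<a)) x₁≈b 0<b exchange

  specialises-μ : ∀ {s k v w} → Specialises s v → Positive v → Exchange k v w → Specialises (μ D k s) w
  specialises-μ {seed xs Bs Zs} (specialisation Bs± Zs≡ x₀≈a x₁≈b) (0<a , 0<b) (exchange₀ exchange) =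
    specialisation (matrix-μ zero Bs±) (coefficients-μ zero Zs≡)
      (cluster-μ₀ {xs} {Bs} {Zs} Bs± (Zs≡ zero) x₀≈a x₁≈b 0<a 0<b exchange) x₁≈b
  specialises-μ {seed xs Bs Zs} (specialisation Bs± Zs≡ x₀≈a x₁≈b) (0<a , 0<b) (exchange₁ exchange) =
    specialisation (matrix-μ (suc zero) Bs±) (coefficients-μ (suc zero) Zs≡)
      x₀≈a (cluster-μ₁ {xs} {Bs} {Zs} Bs± (Zs≡ (suc zero)) x₀≈a x₁≈b 0<a 0<b exchange)

  root-specialises : Specialises S₀ (1 , 1)
  root-specialises = specialisation (inj₁ λ _ _ → refl) (λ _ → refl) (≈-const 1) (≈-const 1)

  module _ {Eq : ℕ → ℕ → Set} (tree : SolutionTree (λ b → V₀ (b ^ suc e)) (λ a → V₁ (a ^ suc c)) Eq) where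
    open SolutionTree tree

    Sol : ℕ × ℕ → Set
    Sol (a , b) = Solution Eq a b

    solution-positive : ∀ {v} → Sol v → Positive v
    solution-positive (0<a , 0<b , _) = 0<a , 0<b

    jump : ∀ k {v} → Sol v → Σ (ℕ × ℕ) λ w → Exchange k v w × Sol w
    jump zero       sol = let a' , product , sol' = jump₀ sol in _ , exchange₀ product , sol'
    jump (suc zero) sol = let b' , product , sol' = jump₁ sol in _ , exchange₁ product , sol'

    size : ℕ × ℕ → ℕ
    size (a , b) = a + b

    descend : ∀ {v} → Sol v →
              v ≡ (1 , 1) ⊎ Σ (Fin 2) λ k → Σ (ℕ × ℕ) λ w → Exchange k v w × Sol w × size w < size v
    descend {a , b} sol with jump₀ sol | jump₁ sol
    ... | a' , product₀ , sol₀ | b' , product₁ , sol₁ with descent sol product₀ product₁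
    ...   | inj₁ (refl , refl) = inj₁ refl
    ...   | inj₂ (inj₁ a'<a)   = inj₂ (zero , _ , exchange₀ product₀ , sol₀ , +-monoˡ-< b a'<a)
    ...   | inj₂ (inj₂ b'<b)   = inj₂ (suc zero , _ , exchange₁ product₁ , sol₁ , +-monoʳ-< a b'<b)

    walk : ∀ t {s v} → Specialises s v → Sol v → Σ (ℕ × ℕ) λ w → Sol w × Specialises (seedAt D s t) w
    walk []      sp sol = _ , sol , sp
    walk (k ∷ t) sp sol = let _ , ex , sol' = jump k sol
                          in walk t (specialises-μ sp (solution-positive sol) ex) sol'

    -- The last mutation of t increased a + b, so mutating once more in the same direction would
    -- decrease it: a climbing path stays reduced when extended by another climbing step.
    Climbs : Vertex → ℕ × ℕ → Set
    Climbs t v = ∀ {k w} → last t ≡ just k → Exchange k v w → size w < size v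

    record Reached (v : ℕ × ℕ) : Set where
      constructor reached
      field
        path        : Vertex
        reduced     : IsVertex path
        specialises : Specialises (seedAt D S₀ path) v
        climbs      : Climbs path v
    open Reached

    no-backtrack : ∀ {k v w} (m : Maybe (Fin 2)) →
                   (∀ {k' u} → m ≡ just k' → Exchange k' w u → size u < size w) →
                   Exchange k w v → size w < size v → Connected _≢_ m (just k)
    no-backtrack nothing   _      _  _   = nothing-just
    no-backtrack (just k') climbs ex w<v = just λ { refl → <-asym w<v (climbs refl ex) }

    reach-up : ∀ {k v w} → Sol w → Sol v → Exchange k w v → size w < size v → Reached w → Reached v
    reach-up {k} {v} {w} sol-w sol-v ex w<v (reached t t-reduced sp climbs) =
      reached (t ∷ʳ k) (++⁺ t-reduced (no-backtrack (last t) climbs ex w<v) [-]) sp' climbs'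
      where
      sp' : Specialises (seedAt D S₀ (t ∷ʳ k)) v
      sp' = subst (λ s → Specialises s v) (sym (seedAt-∷ʳ D S₀ t k))
                  (specialises-μ sp (solution-positive sol-w) ex)
      climbs' : Climbs (t ∷ʳ k) v
      climbs' last≡ ex' with just-injective (trans (sym (last-∷ʳ t k)) last≡)
      ... | refl rewrite exchange-unique (solution-positive sol-v) ex' (exchange-sym ex) = w<v

    reach : ∀ {v} → Acc (_<_ on size) v → Sol v → Reached v
    reach (acc smaller) sol with descend sol
    ... | inj₁ refl                        = reached [] [] root-specialises (λ ())
    ... | inj₂ (_ , _ , ex , sol-w , w<v) =
      reach-up sol-w sol (exchange-sym ex) w<v (reach (smaller w<v) sol-w)

    pattern-solutions : GivesAllSolutions B₊ (pair Z₀ Z₁) D Eq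
    pattern-solutions =
      (λ t _ → let (a , b) , (0<a , 0<b , eq) , sp = walk t root-specialises (0<1+n , 0<1+n , root)
               in a , b , 0<a , 0<b , eq , represents (cluster₀ sp) , represents (cluster₁ sp)) ,
      (λ a b 0<a 0<b eq → let r = reach (On.wellFounded size <-wellFounded (a , b)) (0<a , 0<b , eq)
                          in path r , reduced r , represents (cluster₀ (specialises r))
                                                , represents (cluster₁ (specialises r)))

open ClusterPattern using (pattern-solutions)

-- In the identities below x ^ 2 and x ^ 4 are spelled out as their normal forms x * (x * 1) and
-- x * (x * (x * (x * 1))), since the ring solver does not read _^_ as Data.Nat does.

case-i : GivesAllSolutions (mat (+ 2) -[1+ 1 ]) (pair (1 ∷ 1 ∷ []) (1 ∷ 1 ∷ [])) (pair 1 1)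
           (λ x y → x ^ 2 + y ^ 2 + 1 ≡ 3 * x * y)
case-i = pattern-solutions 1 1 linear linear
  (SolutionTree-resp value value (λ {a} {b} → markov-rearranged (lhs a b) (rhs a b))
    (markov-tree 0 0))
  where
  value : ∀ b → b * b + 0 * b + 1 ≡ 1 + b * (b * 1)
  value b = solve (b ∷ [])
  lhs : ∀ a b → a * a + 0 * a + (b * b + 0 * b + 1) ≡ a * (a * 1) + b * (b * 1) + 1
  lhs a b = solve (a ∷ b ∷ [])
  rhs : ∀ a b → (3 + 0 + 0) * b * a ≡ 3 * a * b
  rhs a b = solve (a ∷ b ∷ [])

case-ii : ∀ k₁ → GivesAllSolutions (mat (+ 1) -[1+ 1 ]) (pair (1 ∷ 1 ∷ []) (1 ∷ k₁ ∷ 1 ∷ [])) (pair 1 2)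
                   (λ x y → x ^ 2 + y ^ 2 + k₁ * x + 1 ≡ (3 + k₁) * x * y)
case-ii k₁ = pattern-solutions 0 1 linear (quadratic k₁)
  (SolutionTree-resp value₀ value₁ (λ {a} {b} → markov-rearranged (lhs a b) (rhs a b))
    (markov-tree k₁ 0))
  where
  value₀ : ∀ b → b * b + 0 * b + 1 ≡ 1 + b * (b * 1)
  value₀ b = solve (b ∷ [])
  value₁ : ∀ a → a * a + k₁ * a + 1 ≡ 1 + k₁ * (a * 1) + a * 1 * (a * 1)
  value₁ a = solve (a ∷ k₁ ∷ [])
  lhs : ∀ a b → a * a + k₁ * a + (b * b + 0 * b + 1) ≡ a * (a * 1) + b * (b * 1) + k₁ * a + 1
  lhs a b = solve (a ∷ b ∷ k₁ ∷ [])
  rhs : ∀ a b → (3 + k₁ + 0) * b * a ≡ (3 + k₁) * a * b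
  rhs a b = solve (a ∷ b ∷ k₁ ∷ [])

case-iii : ∀ k₁ k₂ →
  GivesAllSolutions (mat (+ 1) -[1+ 0 ]) (pair (1 ∷ k₂ ∷ 1 ∷ []) (1 ∷ k₁ ∷ 1 ∷ [])) (pair 2 2)
                    (λ x y → x ^ 2 + y ^ 2 + k₁ * x + k₂ * y + 1 ≡ (3 + k₁ + k₂) * x * y)
case-iii k₁ k₂ = pattern-solutions 0 0 (quadratic k₂) (quadratic k₁)
  (SolutionTree-resp (value k₂) (value k₁) (λ {a} {b} → markov-rearranged (lhs a b) (rhs a b))
    (markov-tree k₁ k₂))
  where
  value : ∀ k a → a * a + k * a + 1 ≡ 1 + k * (a * 1) + a * 1 * (a * 1)
  value k a = solve (a ∷ k ∷ [])
  lhs : ∀ a b → a * a + k₁ * a + (b * b + k₂ * b + 1) ≡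
                a * (a * 1) + b * (b * 1) + k₁ * a + k₂ * b + 1
  lhs a b = solve (a ∷ b ∷ k₁ ∷ k₂ ∷ [])
  rhs : ∀ a b → (3 + k₁ + k₂) * b * a ≡ (3 + k₁ + k₂) * a * b
  rhs a b = solve (a ∷ b ∷ k₁ ∷ k₂ ∷ [])

case-iv : GivesAllSolutions (mat (+ 1) -[1+ 3 ]) (pair (1 ∷ 1 ∷ []) (1 ∷ 1 ∷ [])) (pair 1 1)
            (λ x y → x ^ 2 + y ^ 4 + 2 * x + 1 ≡ 5 * x * y ^ 2)
case-iv = pattern-solutions 0 3 linear linear
  (SolutionTree-resp value₀ value₁ (λ {a} {b} → markov-rearranged (lhs a b) (rhs a b))
    (square-markov-tree 0))
  where
  value₁ : ∀ a → suc a ≡ 1 + a * 1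
  value₁ a = cong suc (sym (*-identityʳ a))
  value₀ : ∀ b → b * b * (b * b) + 0 * (b * b) + 1 ≡ 1 + b * (b * (b * (b * 1)))
  value₀ b = solve (b ∷ [])
  lhs : ∀ a b → a * a + 2 * a + (b * b * (b * b) + 0 * (b * b) + 1) ≡
                a * (a * 1) + b * (b * (b * (b * 1))) + 2 * a + 1
  lhs a b = solve (a ∷ b ∷ [])
  rhs : ∀ a b → (3 + 2 + 0) * (b * b) * a ≡ 5 * a * (b * (b * 1))
  rhs a b = solve (a ∷ b ∷ [])

case-v : ∀ k → GivesAllSolutions (mat (+ 1) -[1+ 1 ]) (pair (1 ∷ k ∷ 1 ∷ []) (1 ∷ 1 ∷ [])) (pair 2 1)
                 (λ x y → x ^ 2 + y ^ 4 + k * y ^ 2 + 2 * x + 1 ≡ (5 + k) * x * y ^ 2)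
case-v k = pattern-solutions 0 1 (quadratic k) linear
  (SolutionTree-resp value₀ value₁ (λ {a} {b} → markov-rearranged (lhs a b) (rhs a b))
    (square-markov-tree k))
  where
  value₁ : ∀ a → suc a ≡ 1 + a * 1
  value₁ a = cong suc (sym (*-identityʳ a))
  value₀ : ∀ b → b * b * (b * b) + k * (b * b) + 1 ≡
                 1 + k * (b * (b * 1)) + b * (b * 1) * (b * (b * 1))
  value₀ b = solve (b ∷ k ∷ [])
  lhs : ∀ a b → a * a + 2 * a + (b * b * (b * b) + k * (b * b) + 1) ≡
                a * (a * 1) + b * (b * (b * (b * 1))) + k * (b * (b * 1)) + 2 * a + 1
  lhs a b = solve (a ∷ b ∷ k ∷ [])
  rhs : ∀ a b → (3 + 2 + k) * (b * b) * a ≡ (5 + k) * a * (b * (b * 1))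
  rhs a b = solve (a ∷ b ∷ k ∷ [])

theorem5p4 : (k k₁ k₂ : ℕ) →
    -- (i) x²+y²+1 = 3xy
    GivesAllSolutions (mat (+ 2) -[1+ 1 ]) (pair (1 ∷ 1 ∷ []) (1 ∷ 1 ∷ [])) (pair 1 1)
      (λ x y → x ^ 2 + y ^ 2 + 1 ≡ 3 * x * y)
    -- (ii) x²+y²+k₁x+1 = (3+k₁)xy
    × GivesAllSolutions (mat (+ 1) -[1+ 1 ]) (pair (1 ∷ 1 ∷ []) (1 ∷ k₁ ∷ 1 ∷ [])) (pair 1 2)
      (λ x y → x ^ 2 + y ^ 2 + k₁ * x + 1 ≡ (3 + k₁) * x * y)
    -- (iii) x²+y²+k₁x+k₂y+1 = (3+k₁+k₂)xy
    × GivesAllSolutions (mat (+ 1) -[1+ 0 ]) (pair (1 ∷ k₂ ∷ 1 ∷ []) (1 ∷ k₁ ∷ 1 ∷ [])) (pair 2 2)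
      (λ x y → x ^ 2 + y ^ 2 + k₁ * x + k₂ * y + 1 ≡ (3 + k₁ + k₂) * x * y)
    -- (iv) x²+y⁴+2x+1 = 5xy²
    × GivesAllSolutions (mat (+ 1) -[1+ 3 ]) (pair (1 ∷ 1 ∷ []) (1 ∷ 1 ∷ [])) (pair 1 1)
      (λ x y → x ^ 2 + y ^ 4 + 2 * x + 1 ≡ 5 * x * y ^ 2)
    -- (v) x²+y⁴+ky²+2x+1 = (5+k)xy²
    × GivesAllSolutions (mat (+ 1) -[1+ 1 ]) (pair (1 ∷ k ∷ 1 ∷ []) (1 ∷ 1 ∷ [])) (pair 2 1)
      (λ x y → x ^ 2 + y ^ 4 + k * y ^ 2 + 2 * x + 1 ≡ (5 + k) * x * y ^ 2)
theorem5p4 k k₁ k₂ = case-i , case-ii k₁ , case-iii k₁ k₂ , case-iv , case-v k
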